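{- Let $k,d$ be positive integers and let $\Lambda\subseteq\mathbf{F}_2^n$ be a set belonging to the family $\mathbf{\Lambda}(2d)$. Let $\Lambda_1\subseteq\Lambda$ and $Q=d\dot{\Lambda}_1$. Then if $k\le|\Lambda_1|/(2d)$, for every integer $p$ with $2\le p\le k$ we have $$T_p(Q)\ge 2^{ -3pd}p^{pd}|Q|^p.$$
   Context: A set $\Lambda=\{\lambda_1,\dots,\lambda_{|\Lambda|}\}\subseteq\mathbf{F}_2^n$ belongs to the family $\mathbf{\Lambda}(k)$ if whenever $\sum_i\varepsilon_i\lambda_i=0$ with $\varepsilon_i\in\{ -1,0,1\}$ and $\sum_i|\varepsilon_i|\le k$, all $\varepsilon_i$ are zero. For a set $\Lambda_1$, $d\dot{\Lambda}_1$ denotes the set of all sums $\lambda_1+\dots+\lambda_d$ of $d$ pairwise distinct elements of $\Lambda_1$. For $A\subseteq\mathbf{F}_2^n$ and an integer $p\ge2$, $T_p(A)$ is the number of tuples $(a_1,\dots,a_p,a_1',\dots,a_p')\in A^{2p}$ with $a_1+\dots+a_p=a_1'+\dots+a_p'$. -}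

module Defs where

open import Data.Bool using (Bool; true; false; _xor_)
import Data.Bool.Properties as BoolP
open import Data.Nat using (ℕ; zero; suc; _+_; _≤_)
open import Data.Fin using (Fin; zero; suc)
open import Data.Vec using (Vec; replicate; zipWith)
import Data.Vec.Properties as VecP
open import Data.List using (List; []; _∷_; map; concatMap; length)
open import Data.Product using (Σ; ∃; _×_; _,_)
open import Relation.Binary.PropositionalEquality using (_≡_)
open import Relation.Nullary using (Dec; yes; no)
open import Function.Definitions using (Injective)

F2 : ℕ → Set
F2 n = Vec Bool n

0v : ∀ {n} → F2 n
0v = replicate _ false

_⊕_ : ∀ {n} → F2 n → F2 n → F2 n
_⊕_ = zipWith _xor_

infixl 6 _⊕_

_≟v_ : ∀ {n} (x y : F2 n) → Dec (x ≡ y)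
_≟v_ = VecP.≡-dec BoolP._≟_

sumF : ∀ {n} (m : ℕ) → (Fin m → F2 n) → F2 n
sumF zero    f = 0v
sumF (suc m) f = f zero ⊕ sumF m (λ i → f (suc i))

data Sign : Set where
  neg zer pos : Sign

-- ε · v in F_2^n (−1 ≡ 1 in F_2).
_·_ : ∀ {n} → Sign → F2 n → F2 n
neg · v = v
zer · v = 0v
pos · v = v

∣_∣ₛ : Sign → ℕ
∣ neg ∣ₛ = 1
∣ zer ∣ₛ = 0
∣ pos ∣ₛ = 1

sumℕ : (m : ℕ) → (Fin m → ℕ) → ℕ
sumℕ zero    f = 0
sumℕ (suc m) f = f zero + sumℕ m (λ i → f (suc i))

-- A set Λ = {λ_1,…,λ_m} ⊆ F_2^n, given by an injective enumeration
-- λ : Fin m → F2 n, belongs to the family Λ(k).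
InFamilyΛ : ∀ {n m} → ℕ → (Fin m → F2 n) → Set
InFamilyΛ {n} {m} k λs =
  (ε : Fin m → Sign) →
  sumF m (λ i → ε i · λs i) ≡ 0v →
  sumℕ m (λ i → ∣ ε i ∣ₛ) ≤ k →
  ∀ i → ε i ≡ zer

-- x ∈ d Λ̇₁ : x is a sum of d pairwise distinct elements of Λ₁
-- (Λ₁ enumerated injectively by λ₁ : Fin m₁ → F2 n).
InDotSum : ∀ {n m₁} → ℕ → (Fin m₁ → F2 n) → F2 n → Set
InDotSum {n} {m₁} d λ₁ x =
  Σ (Fin d → Fin m₁) λ f → Injective _≡_ _≡_ f × sumF d (λ j → λ₁ (f j)) ≡ x

tupleSums : ∀ {n} → List (F2 n) → ℕ → List (F2 n)
tupleSums A zero    = 0v ∷ []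
tupleSums A (suc p) = concatMap (λ s → map (λ a → s ⊕ a) A) (tupleSums A p)

countEq : ∀ {n} → F2 n → List (F2 n) → ℕ
countEq x []       = 0
countEq x (y ∷ ys) with x ≟v y
... | yes _ = suc (countEq x ys)
... | no  _ = countEq x ys

-- T_p(A) for a finite set A given as a duplicate-free list:
-- number of (a,a') ∈ A^p × A^p with a_1+…+a_p = a'_1+…+a'_p.
T : ∀ {n} → ℕ → List (F2 n) → ℕ
T p A = go (tupleSums A p)
  where
  go : List _ → ℕ
  go []       = 0
  go (s ∷ ss) = countEq s (tupleSums A p) + go ss

{-# OPTIONS --safe #-}
module Submission where

-- Subsets of Λ₁ are Boolean vectors u ∈ F₂^{m₁}, and the sum of a subset is the combination
-- Σ uᵢ λ₁ᵢ. Two subsets of size at most d with the same sum differ by a relation of length at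
-- most 2d, so they coincide since Λ ∈ Λ(2d); hence |Q| ≥ C(m₁, d). Every sum of p elements of Q
-- is a sum of at most pd elements of Λ₁, i.e. (after padding with zero vectors) a sum of exactly
-- pd elements of a family of size m₁ + pd, so the |Q|^p tuple sums take at most C(m₁+pd, pd)
-- values and Cauchy–Schwarz gives |Q|^{2p} ≤ C(m₁+pd, pd) T_p(Q). Finally
-- (n/k)^k ≤ C(n, k) ≤ (3n/k)^k yields p^{pd} C(m₁+pd, pd) ≤ 8^{pd} C(m₁, d)^p when 2pd ≤ m₁.

open import Defs
open import Data.Nat using (ℕ; _≤_; _*_; _^_; NonZero)
open import Data.Fin using (Fin)
open import Data.List using (List; length)
open import Data.List.Membership.Propositional using (_∈_)
open import Data.List.Relation.Unary.Unique.Propositional using (Unique)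
open import Data.Product using (∃; _×_)
open import Function.Definitions using (Injective)
open import Function.Bundles using (_⇔_)
open import Relation.Binary.PropositionalEquality using (_≡_)

open import Algebra.Bundles using (CommutativeMonoid; CommutativeRing)
open import Algebra.Definitions using (Associative)
open import Algebra.Structures.Biased using (isCommutativeMonoidˡ)
open import Level using (0ℓ)
open import Data.Bool using (Bool; true; false; _xor_; _∧_; if_then_else_)
open import Data.Bool.Properties using (xor-assoc; xor-comm; xor-same; xor-∧-commutativeRing)
open import Data.Nat hiding (_≟_)
open import Data.Nat.Properties hiding (_≟_; suc-injective)
open import Data.Nat.Combinatorics using (_C_; nC1≡n; nCk+nC[k+1]≡[n+1]C[k+1])
open import Data.Nat.ListAction using (sum)
open import Data.Nat.Tactic.RingSolver using (solve-∀)
open import Data.Fin using (zero; suc)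
open import Data.Fin.Properties using (_≟_; suc-injective)
open import Data.Vec using (Vec; []; _∷_; replicate; tabulate; lookup; _++_)
open import Data.Vec.Properties using (zipWith-assoc; zipWith-comm; lookup∘tabulate; lookup-replicate; ∷-injectiveʳ)
open import Data.Vec.Functional using () renaming (_∷_ to _∷ᶠ_)
open import Data.List using ([]; _∷_; map; concatMap; filter) renaming (_++_ to _++ˡ_)
open import Data.List.Properties using (length-map; length-++; length-removeAt′)
open import Data.List.Membership.Propositional using (_─_)
open import Data.List.Membership.Propositional.Properties
  using (∈-map⁺; ∈-map⁻; ∈-++⁺ˡ; ∈-++⁺ʳ; ∈-++⁻; ∈-concat⁻′; ∈-filter⁻)
open import Data.List.Relation.Unary.Any using (here; there; index)
open import Data.List.Relation.Unary.All using (All; []; _∷_)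
import Data.List.Relation.Unary.All as All
open import Data.List.Relation.Unary.All.Properties using (all-filter)
open import Data.List.Relation.Unary.AllPairs using ([]; _∷_)
import Data.List.Relation.Unary.Unique.Propositional.Properties as Unique
open import Data.Product using (Σ; _,_; proj₁; proj₂)
open import Data.Sum using (inj₁; inj₂)
open import Data.Empty using (⊥; ⊥-elim)
open import Function using (_∘_)
open import Function.Bundles using (Equivalence)
open import Relation.Binary.PropositionalEquality
  using (_≢_; refl; sym; trans; cong; cong₂; subst; subst₂; isEquivalence; module ≡-Reasoning)
open import Relation.Nullary using (yes; no; does; ¬?)
open import Relation.Nullary.Decidable using (dec-true; dec-false)
open import Relation.Unary using (Decidable)
import Algebra.Properties.CommutativeSemigroup as CommSemigroupProperties
open CommSemigroupProperties *-commutativeSemigroup using (x∙yz≈y∙xz; x∙yz≈yx∙z; xy∙z≈y∙xz; interchange)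
open CommSemigroupProperties +-commutativeSemigroup
  using () renaming (x∙yz≈y∙xz to x+[y+z]≡y+[x+z]; interchange to +-interchange)

-- Binomial coefficients and elementary inequalities

^-distribʳ-* : ∀ m n k → (m * n) ^ k ≡ m ^ k * n ^ k
^-distribʳ-* m n zero    = refl
^-distribʳ-* m n (suc k) = begin
  (m * n) * (m * n) ^ k     ≡⟨ cong ((m * n) *_) (^-distribʳ-* m n k) ⟩
  (m * n) * (m ^ k * n ^ k) ≡⟨ interchange m n (m ^ k) (n ^ k) ⟩
  (m * m ^ k) * (n * n ^ k) ∎
  where open ≡-Reasoning

[n+1]C[k+1]≡nCk+nC[k+1] : ∀ n k → suc n C suc k ≡ n C k + n C suc k
[n+1]C[k+1]≡nCk+nC[k+1] n k = sym (nCk+nC[k+1]≡[n+1]C[k+1] n k)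

nCk>0 : ∀ {n k} → k ≤ n → n C k > 0
nCk>0 {n}     {zero}  _         = s≤s z≤n
nCk>0 {suc n} {suc k} (s≤s k≤n) rewrite [n+1]C[k+1]≡nCk+nC[k+1] n k = ≤-trans (nCk>0 k≤n) (m≤m+n _ _)

[k+1]*[n+1]C[k+1]≡[n+1]*nCk : ∀ n k → suc k * (suc n C suc k) ≡ suc n * (n C k)
[k+1]*[n+1]C[k+1]≡[n+1]*nCk zero    zero    = refl
[k+1]*[n+1]C[k+1]≡[n+1]*nCk zero    (suc k) = *-zeroʳ (2 + k)
[k+1]*[n+1]C[k+1]≡[n+1]*nCk (suc n) zero    = trans (+-identityʳ _) (trans (nC1≡n (2 + n)) (sym (*-identityʳ (2 + n))))
[k+1]*[n+1]C[k+1]≡[n+1]*nCk (suc n) (suc k) = begin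
  suc (suc k) * (suc (suc n) C suc (suc k))      ≡⟨ cong (suc (suc k) *_) ([n+1]C[k+1]≡nCk+nC[k+1] (suc n) (suc k)) ⟩
  suc (suc k) * (X + Y)                          ≡⟨ *-distribˡ-+ (suc (suc k)) X Y ⟩
  (X + suc k * X) + suc (suc k) * Y              ≡⟨ cong₂ (λ a b → (X + a) + b) ([k+1]*[n+1]C[k+1]≡[n+1]*nCk n k) ([k+1]*[n+1]C[k+1]≡[n+1]*nCk n (suc k)) ⟩
  (X + suc n * (n C k)) + suc n * (n C suc k)    ≡⟨ +-assoc X _ _ ⟩
  X + (suc n * (n C k) + suc n * (n C suc k))    ≡⟨ cong (X +_) (sym (*-distribˡ-+ (suc n) (n C k) _)) ⟩
  X + suc n * (n C k + n C suc k)                ≡⟨ cong (λ c → X + suc n * c) (sym ([n+1]C[k+1]≡nCk+nC[k+1] n k)) ⟩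
  suc (suc n) * X                                ∎
  where
  open ≡-Reasoning
  X = suc n C suc k
  Y = suc n C suc (suc k)

k!*nCk≤n^k : ∀ n k → k ! * (n C k) ≤ n ^ k
k!*nCk≤n^k n       zero    = ≤-refl
k!*nCk≤n^k zero    (suc k) = ≤-reflexive (*-zeroʳ (suc k !))
k!*nCk≤n^k (suc n) (suc k) = begin
  (suc k * k !) * (suc n C suc k) ≡⟨ xy∙z≈y∙xz (suc k) (k !) _ ⟩
  k ! * (suc k * (suc n C suc k)) ≡⟨ cong (k ! *_) ([k+1]*[n+1]C[k+1]≡[n+1]*nCk n k) ⟩
  k ! * (suc n * (n C k))           ≡⟨ x∙yz≈y∙xz (k !) (suc n) _ ⟩
  suc n * (k ! * (n C k))           ≤⟨ *-monoʳ-≤ (suc n) (k!*nCk≤n^k n k) ⟩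
  suc n * n ^ k                   ≤⟨ *-monoʳ-≤ (suc n) (^-monoˡ-≤ k (n≤1+n n)) ⟩
  suc n * suc n ^ k               ∎
  where
  open ≤-Reasoning

n^n>0 : ∀ n → n ^ n > 0
n^n>0 zero        = s≤s z≤n
n^n>0 n@(suc _)   = m^n>0 n n

n^k≤k^k*nCk : ∀ {n k} → k ≤ n → n ^ k ≤ k ^ k * (n C k)
n^k≤k^k*nCk {n}     {zero}  _         = ≤-refl
n^k≤k^k*nCk {suc n} {suc k} (s≤s k≤n) = *-cancelˡ-≤ (k ^ k) {{k^k≢0}} (begin
  k ^ k * (suc n * suc n ^ k)          ≡⟨ x∙yz≈y∙xz (k ^ k) (suc n) _ ⟩
  suc n * (k ^ k * suc n ^ k)          ≡⟨ cong (suc n *_) (sym (^-distribʳ-* k (suc n) k)) ⟩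
  suc n * (k * suc n) ^ k              ≤⟨ *-monoʳ-≤ (suc n) (^-monoˡ-≤ k k[1+n]≤[1+k]n) ⟩
  suc n * (suc k * n) ^ k              ≡⟨ cong (suc n *_) (^-distribʳ-* (suc k) n k) ⟩
  suc n * (suc k ^ k * n ^ k)          ≤⟨ *-monoʳ-≤ (suc n) (*-monoʳ-≤ (suc k ^ k) (n^k≤k^k*nCk k≤n)) ⟩
  suc n * (suc k ^ k * (k ^ k * (n C k))) ≡⟨ regroup (suc n) (suc k ^ k) (k ^ k) (n C k) ⟩
  k ^ k * (suc k ^ k * (suc n * (n C k))) ≡⟨ cong (λ x → k ^ k * (suc k ^ k * x)) (sym ([k+1]*[n+1]C[k+1]≡[n+1]*nCk n k)) ⟩
  k ^ k * (suc k ^ k * (suc k * (suc n C suc k))) ≡⟨ cong (k ^ k *_) (x∙yz≈yx∙z (suc k ^ k) (suc k) _) ⟩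
  k ^ k * (suc k ^ suc k * (suc n C suc k)) ∎)
  where
  open ≤-Reasoning
  k^k≢0 : NonZero (k ^ k)
  k^k≢0 = >-nonZero (n^n>0 k)
  k[1+n]≤[1+k]n : k * suc n ≤ suc k * n
  k[1+n]≤[1+k]n = begin
    k * suc n ≡⟨ *-suc k n ⟩
    k + k * n ≤⟨ +-monoˡ-≤ (k * n) k≤n ⟩
    n + k * n ∎
  regroup : ∀ a b c e → a * (b * (c * e)) ≡ c * (b * (a * e))
  regroup = solve-∀

-- (1 + 1/n)^k ≤ 1 + k/n + (k/n)² for k ≤ n; at k = n this gives (1 + 1/n)^n ≤ 3.
[n+1]^k*n²≤n^k*[n²+kn+k²] : ∀ n k → k ≤ n → suc n ^ k * (n * n) ≤ n ^ k * (n * n + k * n + k * k)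
[n+1]^k*n²≤n^k*[n²+kn+k²] n zero    _   = ≤-reflexive (base n)
  where
  base : ∀ n → 1 * (n * n) ≡ 1 * (n * n + 0 * n + 0 * 0)
  base = solve-∀
[n+1]^k*n²≤n^k*[n²+kn+k²] n (suc k) k<n = begin
  (suc n * suc n ^ k) * (n * n) ≡⟨ *-assoc (suc n) (suc n ^ k) (n * n) ⟩
  suc n * (suc n ^ k * (n * n)) ≤⟨ *-monoʳ-≤ (suc n) ([n+1]^k*n²≤n^k*[n²+kn+k²] n k (<⇒≤ k<n)) ⟩
  suc n * (n ^ k * P)           ≡⟨ x∙yz≈y∙xz (suc n) (n ^ k) P ⟩
  n ^ k * (suc n * P)           ≤⟨ *-monoʳ-≤ (n ^ k) step ⟩
  n ^ k * (n * R)               ≡⟨ sym (*-assoc (n ^ k) n R) ⟩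
  n ^ k * n * R                 ≡⟨ cong (_* R) (*-comm (n ^ k) n) ⟩
  (n * n ^ k) * R               ∎
  where
  open ≤-Reasoning
  P = n * n + k * n + k * k
  R = n * n + suc k * n + suc k * suc k
  expand : ∀ n k → suc n * (n * n + k * n + k * k) + (k * n + n)
                 ≡ n * (n * n + suc k * n + suc k * suc k) + k * k
  expand = solve-∀
  k²≤kn+n : k * k ≤ k * n + n
  k²≤kn+n = ≤-trans (*-monoʳ-≤ k (<⇒≤ k<n)) (m≤m+n (k * n) n)
  step : suc n * P ≤ n * R
  step = +-cancelʳ-≤ (k * n + n) _ _ (begin
    suc n * P + (k * n + n) ≡⟨ expand n k ⟩
    n * R + k * k           ≤⟨ +-monoʳ-≤ (n * R) k²≤kn+n ⟩
    n * R + (k * n + n)     ∎)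

[n+1]^n≤3*n^n : ∀ n → suc n ^ n ≤ 3 * n ^ n
[n+1]^n≤3*n^n zero      = s≤s z≤n
[n+1]^n≤3*n^n n@(suc _) = *-cancelʳ-≤ _ _ (n * n) (begin
  suc n ^ n * (n * n)             ≤⟨ [n+1]^k*n²≤n^k*[n²+kn+k²] n n ≤-refl ⟩
  n ^ n * (n * n + n * n + n * n) ≡⟨ triple (n ^ n) (n * n) ⟩
  3 * n ^ n * (n * n)             ∎)
  where
  open ≤-Reasoning
  triple : ∀ a b → a * (b + b + b) ≡ 3 * a * b
  triple = solve-∀

n^n≤3^n*n! : ∀ n → n ^ n ≤ 3 ^ n * n !
n^n≤3^n*n! zero    = ≤-refl
n^n≤3^n*n! (suc n) = begin
  suc n * suc n ^ n           ≤⟨ *-monoʳ-≤ (suc n) ([n+1]^n≤3*n^n n) ⟩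
  suc n * (3 * n ^ n)         ≤⟨ *-monoʳ-≤ (suc n) (*-monoʳ-≤ 3 (n^n≤3^n*n! n)) ⟩
  suc n * (3 * (3 ^ n * n !)) ≡⟨ regroup (suc n) (3 ^ n) (n !) ⟩
  (3 * 3 ^ n) * (suc n * n !) ∎
  where
  open ≤-Reasoning
  regroup : ∀ a b c → a * (3 * (b * c)) ≡ (3 * b) * (a * c)
  regroup = solve-∀

n^[pk]≤k^[pk]*[nCk]^p : ∀ {n k} p → k ≤ n → n ^ (p * k) ≤ k ^ (p * k) * (n C k) ^ p
n^[pk]≤k^[pk]*[nCk]^p {n} {k} p k≤n = begin
  n ^ (p * k)             ≡⟨ cong (n ^_) (*-comm p k) ⟩
  n ^ (k * p)             ≡⟨ sym (^-*-assoc n k p) ⟩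
  (n ^ k) ^ p             ≤⟨ ^-monoˡ-≤ p (n^k≤k^k*nCk k≤n) ⟩
  (k ^ k * (n C k)) ^ p   ≡⟨ ^-distribʳ-* (k ^ k) (n C k) p ⟩
  (k ^ k) ^ p * (n C k) ^ p ≡⟨ cong (_* (n C k) ^ p) (trans (^-*-assoc k k p) (cong (k ^_) (*-comm k p))) ⟩
  k ^ (p * k) * (n C k) ^ p ∎
  where open ≤-Reasoning

p^[pd]*[m+pd]C[pd]≤8^[pd]*[mCd]^p : ∀ {p d m} .{{_ : NonZero p}} .{{_ : NonZero d}} → 2 * (p * d) ≤ m →
  p ^ (p * d) * ((m + p * d) C (p * d)) ≤ 8 ^ (p * d) * (m C d) ^ p
p^[pd]*[m+pd]C[pd]≤8^[pd]*[mCd]^p {p} {d} {m} 2t≤m = *-cancelˡ-≤ (d ^ t) {{m^n≢0 d t}} (begin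
  d ^ t * (p ^ t * B)           ≡⟨ x∙yz≈yx∙z (d ^ t) (p ^ t) B ⟩
  (p ^ t * d ^ t) * B           ≡⟨ cong (_* B) (sym (^-distribʳ-* p d t)) ⟩
  t ^ t * B                     ≤⟨ *-monoˡ-≤ B (n^n≤3^n*n! t) ⟩
  (3 ^ t * t !) * B             ≡⟨ *-assoc (3 ^ t) (t !) B ⟩
  3 ^ t * (t ! * B)             ≤⟨ *-monoʳ-≤ (3 ^ t) (k!*nCk≤n^k (m + t) t) ⟩
  3 ^ t * (m + t) ^ t           ≡⟨ sym (^-distribʳ-* 3 (m + t) t) ⟩
  (3 * (m + t)) ^ t             ≤⟨ ^-monoˡ-≤ t 3[m+t]≤8m ⟩
  (8 * m) ^ t                   ≡⟨ ^-distribʳ-* 8 m t ⟩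
  8 ^ t * m ^ t                 ≤⟨ *-monoʳ-≤ (8 ^ t) (n^[pk]≤k^[pk]*[nCk]^p p d≤m) ⟩
  8 ^ t * (d ^ t * (m C d) ^ p) ≡⟨ x∙yz≈y∙xz (8 ^ t) (d ^ t) _ ⟩
  d ^ t * (8 ^ t * (m C d) ^ p) ∎)
  where
  open ≤-Reasoning
  t = p * d
  B = (m + t) C t
  t≤m : t ≤ m
  t≤m = ≤-trans (m≤n*m t 2) 2t≤m
  d≤m : d ≤ m
  d≤m = ≤-trans (m≤n*m d p) t≤m
  3[m+m]≡6m : ∀ m → 3 * (m + m) ≡ 6 * m
  3[m+m]≡6m = solve-∀
  3[m+t]≤8m : 3 * (m + t) ≤ 8 * m
  3[m+t]≤8m = begin
    3 * (m + t) ≤⟨ *-monoʳ-≤ 3 (+-monoʳ-≤ m t≤m) ⟩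
    3 * (m + m) ≡⟨ 3[m+m]≡6m m ⟩
    6 * m       ≤⟨ *-monoˡ-≤ m (m≤m+n 6 2) ⟩
    8 * m       ∎

a²+[a+k]²≡2a[a+k]+k² : ∀ a k → a * a + (a + k) * (a + k) ≡ 2 * (a * (a + k)) + k * k
a²+[a+k]²≡2a[a+k]+k² = solve-∀

2ab≤a²+b² : ∀ a b → 2 * (a * b) ≤ a * a + b * b
2ab≤a²+b² a b with ≤-total a b
... | inj₁ a≤b with k , refl ← m≤n⇒∃[o]m+o≡n a≤b =
  ≤-trans (m≤m+n _ (k * k)) (≤-reflexive (sym (a²+[a+k]²≡2a[a+k]+k² a k)))
... | inj₂ b≤a with k , refl ← m≤n⇒∃[o]m+o≡n b≤a =
  subst₂ _≤_ (cong (2 *_) (*-comm b (b + k))) (+-comm (b * b) _)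
         (≤-trans (m≤m+n _ (k * k)) (≤-reflexive (sym (a²+[a+k]²≡2a[a+k]+k² b k))))

2ab≤ka²+y : ∀ a b k y → b * b ≤ k * y → 2 * (a * b) ≤ k * (a * a) + y
2ab≤ka²+y a zero    k       y _   = subst (_≤ k * (a * a) + y) (sym (cong (2 *_) (*-zeroʳ a))) z≤n
2ab≤ka²+y a (suc b) zero    y ()
2ab≤ka²+y a b       k@(suc _) y b²≤ky = *-cancelˡ-≤ k (begin
  k * (2 * (a * b))         ≡⟨ regroupˡ k a b ⟩
  2 * ((k * a) * b)         ≤⟨ 2ab≤a²+b² (k * a) b ⟩
  (k * a) * (k * a) + b * b ≤⟨ +-monoʳ-≤ _ b²≤ky ⟩
  (k * a) * (k * a) + k * y ≡⟨ regroupʳ k a y ⟩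
  k * (k * (a * a) + y)     ∎)
  where
  open ≤-Reasoning
  regroupˡ : ∀ k a b → k * (2 * (a * b)) ≡ 2 * ((k * a) * b)
  regroupˡ = solve-∀
  regroupʳ : ∀ k a y → (k * a) * (k * a) + k * y ≡ k * (k * (a * a) + y)
  regroupʳ = solve-∀

-- The group F₂ⁿ and Boolean combinations in a commutative monoid

⊕-assoc : ∀ {n} → Associative _≡_ (_⊕_ {n})
⊕-assoc = zipWith-assoc xor-assoc

⊕-comm : ∀ {n} (x y : F2 n) → x ⊕ y ≡ y ⊕ x
⊕-comm = zipWith-comm xor-comm

⊕-identityˡ : ∀ {n} (x : F2 n) → 0v ⊕ x ≡ x
⊕-identityˡ []      = refl
⊕-identityˡ (a ∷ x) = cong (a ∷_) (⊕-identityˡ x)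

⊕-identityʳ : ∀ {n} (x : F2 n) → x ⊕ 0v ≡ x
⊕-identityʳ x = trans (⊕-comm x 0v) (⊕-identityˡ x)

x⊕x≡0v : ∀ {n} (x : F2 n) → x ⊕ x ≡ 0v
x⊕x≡0v []      = refl
x⊕x≡0v (a ∷ x) = cong₂ _∷_ (xor-same a) (x⊕x≡0v x)

x⊕y≡0v⇒x≡y : ∀ {n} {x y : F2 n} → x ⊕ y ≡ 0v → x ≡ y
x⊕y≡0v⇒x≡y {x = x} {y} x⊕y≡0v = begin
  x             ≡⟨ sym (⊕-identityʳ x) ⟩
  x ⊕ 0v        ≡⟨ cong (x ⊕_) (sym (x⊕x≡0v y)) ⟩
  x ⊕ (y ⊕ y)   ≡⟨ sym (⊕-assoc x y y) ⟩
  (x ⊕ y) ⊕ y   ≡⟨ cong (_⊕ y) x⊕y≡0v ⟩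
  0v ⊕ y        ≡⟨ ⊕-identityˡ y ⟩
  y             ∎
  where open ≡-Reasoning

⊕-commutativeMonoid : ℕ → CommutativeMonoid 0ℓ 0ℓ
⊕-commutativeMonoid n = record
  { _∙_ = _⊕_ {n}
  ; ε   = 0v
  ; isCommutativeMonoid = isCommutativeMonoidˡ record
    { isSemigroup = record
      { isMagma = record { isEquivalence = isEquivalence ; ∙-cong = cong₂ _⊕_ }
      ; assoc   = ⊕-assoc
      }
    ; identityˡ = ⊕-identityˡ
    ; comm      = ⊕-comm
    }
  }

⊕-interchange : ∀ {n} (p q r s : F2 n) → (p ⊕ q) ⊕ (r ⊕ s) ≡ (p ⊕ r) ⊕ (q ⊕ s)
⊕-interchange {n} = CommSemigroupProperties.interchange
                      (CommutativeMonoid.commutativeSemigroup (⊕-commutativeMonoid n))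

xor-commutativeMonoid : CommutativeMonoid 0ℓ 0ℓ
xor-commutativeMonoid = CommutativeRing.+-commutativeMonoid xor-∧-commutativeRing

unit : ∀ {m} → Fin m → F2 m
unit i = tabulate (λ j → does (i ≟ j))

module BooleanCombinations (M : CommutativeMonoid 0ℓ 0ℓ) where

  open CommutativeMonoid M
    using (Carrier; _∙_; _≈_; setoid; ∙-cong; ∙-congˡ; assoc; identityˡ; identityʳ)
    renaming (ε to 0#; refl to ≈-refl; sym to ≈-sym; trans to ≈-trans; reflexive to ≈-reflexive)
  open import Algebra.Properties.CommutativeMonoid.Sum M public
    using (sum; sum-syntax; ∑-comm; sum-cong-≋; sum-cong-≗; sum-replicate-zero)
  open import Relation.Binary.Reasoning.Setoid setoid

  infixr 8 _·ᵇ_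

  _·ᵇ_ : Bool → Carrier → Carrier
  true  ·ᵇ x = x
  false ·ᵇ x = 0#

  ∧-·ᵇ : ∀ a b x → (a ∧ b) ·ᵇ x ≡ a ·ᵇ b ·ᵇ x
  ∧-·ᵇ true  b x = refl
  ∧-·ᵇ false b x = refl

  ∑-δ : ∀ {m} (δ : Fin m → Bool) {i} → δ i ≡ true → (∀ j → j ≢ i → δ j ≡ false) →
        (f : Fin m → Carrier) → ∑[ j < m ] (δ j ·ᵇ f j) ≈ f i
  ∑-δ {suc m} δ {zero} δi δj f = begin
    δ zero ·ᵇ f zero ∙ ∑[ j < m ] (δ (suc j) ·ᵇ f (suc j)) ≈⟨ ∙-cong (≈-reflexive (cong (_·ᵇ f zero) δi)) rest≈0 ⟩
    f zero ∙ 0#                                          ≈⟨ identityʳ (f zero) ⟩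
    f zero                                               ∎
    where
    rest≈0 : ∑[ j < m ] (δ (suc j) ·ᵇ f (suc j)) ≈ 0#
    rest≈0 = ≈-trans (≈-reflexive (sum-cong-≗ λ j → cong (_·ᵇ f (suc j)) (δj (suc j) λ ())))
                   (sum-replicate-zero m)
  ∑-δ {suc m} δ {suc i} δi δj f = begin
    δ zero ·ᵇ f zero ∙ ∑[ j < m ] (δ (suc j) ·ᵇ f (suc j)) ≈⟨ ∙-cong (≈-reflexive (cong (_·ᵇ f zero) (δj zero λ ()))) ≈-refl ⟩
    0# ∙ ∑[ j < m ] (δ (suc j) ·ᵇ f (suc j))               ≈⟨ identityˡ _ ⟩
    ∑[ j < m ] (δ (suc j) ·ᵇ f (suc j))                    ≈⟨ ∑-δ (δ ∘ suc) δi (λ j j≢i → δj (suc j) (j≢i ∘ suc-injective)) (f ∘ suc) ⟩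
    f (suc i)                                            ∎

  ∑-δ-≟ : ∀ {m} (i : Fin m) (f : Fin m → Carrier) → ∑[ j < m ] (does (i ≟ j) ·ᵇ f j) ≈ f i
  ∑-δ-≟ i = ∑-δ (λ j → does (i ≟ j)) (dec-true (i ≟ i) refl) (λ j j≢i → dec-false (i ≟ j) (j≢i ∘ sym))

  ∑-pushforward : ∀ {m k} (g : Fin m → Fin k) (b : Fin m → Bool) (f : Fin k → Carrier) →
    ∑[ j < k ] ∑[ i < m ] ((does (g i ≟ j) ∧ b i) ·ᵇ f j) ≈ ∑[ i < m ] (b i ·ᵇ f (g i))
  ∑-pushforward {m} {k} g b f = begin
    ∑[ j < k ] ∑[ i < m ] ((does (g i ≟ j) ∧ b i) ·ᵇ f j) ≈⟨ ≈-sym (∑-comm (λ i j → (does (g i ≟ j) ∧ b i) ·ᵇ f j)) ⟩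
    ∑[ i < m ] ∑[ j < k ] ((does (g i ≟ j) ∧ b i) ·ᵇ f j) ≈⟨ sum-cong-≋ (λ i → ≈-reflexive (sum-cong-≗ (λ j → ∧-·ᵇ (does (g i ≟ j)) (b i) (f j)))) ⟩
    ∑[ i < m ] ∑[ j < k ] (does (g i ≟ j) ·ᵇ b i ·ᵇ f j)  ≈⟨ sum-cong-≋ (λ i → ∑-δ-≟ (g i) (λ j → b i ·ᵇ f j)) ⟩
    ∑[ i < m ] (b i ·ᵇ f (g i))                        ∎

  combination : ∀ {m} → Vec Bool m → Vec Carrier m → Carrier
  combination []      []       = 0#
  combination (b ∷ u) (a ∷ as) = b ·ᵇ a ∙ combination u as

  combination-lookup : ∀ {m} (u : Vec Bool m) (as : Vec Carrier m) →
    combination u as ≡ ∑[ i < m ] (lookup u i ·ᵇ lookup as i)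
  combination-lookup []      []       = refl
  combination-lookup (b ∷ u) (a ∷ as) = cong (b ·ᵇ a ∙_) (combination-lookup u as)

  combination-++ : ∀ {m k} (u : Vec Bool m) (v : Vec Bool k) as bs →
    combination (u ++ v) (as ++ bs) ≈ combination u as ∙ combination v bs
  combination-++ []      v []       bs = ≈-sym (identityˡ _)
  combination-++ (b ∷ u) v (a ∷ as) bs = ≈-trans (∙-congˡ (combination-++ u v as bs)) (≈-sym (assoc _ _ _))

  combination-replicate-0# : ∀ {m} (u : Vec Bool m) → combination u (replicate m 0#) ≈ 0#
  combination-replicate-0# []          = ≈-refl
  combination-replicate-0# (true ∷ u)  = ≈-trans (identityˡ _) (combination-replicate-0# u)
  combination-replicate-0# (false ∷ u) = ≈-trans (identityˡ _) (combination-replicate-0# u)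

  combination-0v : ∀ {m} (as : Vec Carrier m) → combination 0v as ≈ 0#
  combination-0v []       = ≈-refl
  combination-0v (a ∷ as) = ≈-trans (identityˡ _) (combination-0v as)

  combination-unit : ∀ {m} (i : Fin m) (as : Vec Carrier m) → combination (unit i) as ≈ lookup as i
  combination-unit {m} i as = begin
    combination (unit i) as                                ≡⟨ combination-lookup (unit i) as ⟩
    ∑[ j < m ] (lookup (unit i) j ·ᵇ lookup as j)          ≡⟨ sum-cong-≗ (λ j → cong (_·ᵇ lookup as j) (lookup∘tabulate _ j)) ⟩
    ∑[ j < m ] (does (i ≟ j) ·ᵇ lookup as j)               ≈⟨ ∑-δ-≟ i (lookup as) ⟩
    lookup as i                                            ∎

module F2ⁿ {n : ℕ} = BooleanCombinations (⊕-commutativeMonoid n)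
module Nat = BooleanCombinations +-0-commutativeMonoid
module Xor = BooleanCombinations xor-commutativeMonoid

open F2ⁿ hiding (sum)

xor-·ᵇ : ∀ {n} a b (x : F2 n) → (a xor b) ·ᵇ x ≡ a ·ᵇ x ⊕ b ·ᵇ x
xor-·ᵇ true  true  x = sym (x⊕x≡0v x)
xor-·ᵇ true  false x = sym (⊕-identityʳ x)
xor-·ᵇ false b     x = sym (⊕-identityˡ _)

⨁-·ᵇ : ∀ {n m} (c : Fin m → Bool) (x : F2 n) → Xor.sum c ·ᵇ x ≡ ∑[ i < m ] (c i ·ᵇ x)
⨁-·ᵇ {m = zero}  c x = refl
⨁-·ᵇ {m = suc m} c x = trans (xor-·ᵇ (c zero) _ x) (cong (c zero ·ᵇ x ⊕_) (⨁-·ᵇ (c ∘ suc) x))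

combination-⊕ : ∀ {n m} (u w : F2 m) (as : Vec (F2 n) m) →
  combination (u ⊕ w) as ≡ combination u as ⊕ combination w as
combination-⊕ []      []      []       = sym (⊕-identityˡ 0v)
combination-⊕ (a ∷ u) (b ∷ w) (x ∷ as) = begin
  (a xor b) ·ᵇ x ⊕ combination (u ⊕ w) as                          ≡⟨ cong₂ _⊕_ (xor-·ᵇ a b x) (combination-⊕ u w as) ⟩
  (a ·ᵇ x ⊕ b ·ᵇ x) ⊕ (combination u as ⊕ combination w as)        ≡⟨ ⊕-interchange _ _ _ _ ⟩
  (a ·ᵇ x ⊕ combination u as) ⊕ (b ·ᵇ x ⊕ combination w as)        ∎
  where open ≡-Reasoning

combination-∑ : ∀ {n m d} (u : Fin d → F2 m) (as : Vec (F2 n) m) →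
  combination (∑[ j < d ] u j) as ≡ ∑[ j < d ] combination (u j) as
combination-∑ {d = zero}  u as = combination-0v as
combination-∑ {d = suc d} u as =
  trans (combination-⊕ (u zero) _ as) (cong (combination (u zero) as ⊕_) (combination-∑ (u ∘ suc) as))

weight : ∀ {m} → F2 m → ℕ
weight u = Nat.combination u (replicate _ 1)

xor-·ᵇ1≤ : ∀ a b → (a xor b) Nat.·ᵇ 1 ≤ a Nat.·ᵇ 1 + b Nat.·ᵇ 1
xor-·ᵇ1≤ true  true  = z≤n
xor-·ᵇ1≤ true  false = ≤-refl
xor-·ᵇ1≤ false b     = ≤-refl

⨁-·ᵇ1≤ : ∀ {m} (c : Fin m → Bool) → Xor.sum c Nat.·ᵇ 1 ≤ Nat.sum (λ i → c i Nat.·ᵇ 1)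
⨁-·ᵇ1≤ {zero}  c = z≤n
⨁-·ᵇ1≤ {suc m} c = ≤-trans (xor-·ᵇ1≤ (c zero) _) (+-monoʳ-≤ (c zero Nat.·ᵇ 1) (⨁-·ᵇ1≤ (c ∘ suc)))

sum-mono-≤ : ∀ {m} {f g : Fin m → ℕ} → (∀ i → f i ≤ g i) → Nat.sum f ≤ Nat.sum g
sum-mono-≤ {zero}  f≤g = z≤n
sum-mono-≤ {suc m} f≤g = +-mono-≤ (f≤g zero) (sum-mono-≤ (f≤g ∘ suc))

sum-ones : ∀ m → Nat.sum {m} (λ _ → 1) ≡ m
sum-ones zero    = refl
sum-ones (suc m) = cong suc (sum-ones m)

weight-⊕ : ∀ {m} (u w : F2 m) → weight (u ⊕ w) ≤ weight u + weight w
weight-⊕ []      []      = z≤n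
weight-⊕ (a ∷ u) (b ∷ w) = begin
  (a xor b) Nat.·ᵇ 1 + weight (u ⊕ w)                       ≤⟨ +-mono-≤ (xor-·ᵇ1≤ a b) (weight-⊕ u w) ⟩
  (a Nat.·ᵇ 1 + b Nat.·ᵇ 1) + (weight u + weight w)          ≡⟨ +-interchange (a Nat.·ᵇ 1) (b Nat.·ᵇ 1) (weight u) (weight w) ⟩
  (a Nat.·ᵇ 1 + weight u) + (b Nat.·ᵇ 1 + weight w)          ∎
  where
  open ≤-Reasoning

weight-∑ : ∀ {m d} (u : Fin d → F2 m) → weight (∑[ j < d ] u j) ≤ Nat.sum (λ j → weight (u j))
weight-∑ {m} {zero}  u = ≤-reflexive (Nat.combination-0v (replicate m 1))
weight-∑ {d = suc d} u = ≤-trans (weight-⊕ (u zero) _) (+-monoʳ-≤ (weight (u zero)) (weight-∑ (u ∘ suc)))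

weight-unit : ∀ {m} (i : Fin m) → weight (unit i) ≡ 1
weight-unit i = trans (Nat.combination-unit i _) (lookup-replicate i 1)

replicate-+ : ∀ {A : Set} m k (x : A) → replicate (m + k) x ≡ replicate m x ++ replicate k x
replicate-+ zero    k x = refl
replicate-+ (suc m) k x = cong (x ∷_) (replicate-+ m k x)

weight-++ : ∀ {m k} (u : F2 m) (v : F2 k) → weight (u ++ v) ≡ weight u + weight v
weight-++ {m} {k} u v = trans (cong (Nat.combination (u ++ v)) (replicate-+ m k 1))
                               (Nat.combination-++ u v (replicate m 1) (replicate k 1))

-- Relations with 0/1 coefficients

sumF≡∑ : ∀ {n} m (f : Fin m → F2 n) → sumF m f ≡ ∑[ i < m ] f i
sumF≡∑ zero    f = refl
sumF≡∑ (suc m) f = cong (f zero ⊕_) (sumF≡∑ m (f ∘ suc))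

sumℕ≡∑ : ∀ m (f : Fin m → ℕ) → sumℕ m f ≡ Nat.sum f
sumℕ≡∑ zero    f = refl
sumℕ≡∑ (suc m) f = cong (f zero +_) (sumℕ≡∑ m (f ∘ suc))

toSign : Bool → Sign
toSign true  = pos
toSign false = zer

toSign-· : ∀ {n} b (x : F2 n) → toSign b · x ≡ b ·ᵇ x
toSign-· true  x = refl
toSign-· false x = refl

∣toSign∣ : ∀ b → ∣ toSign b ∣ₛ ≡ b Nat.·ᵇ 1
∣toSign∣ true  = refl
∣toSign∣ false = refl

toSign≡zer⇒false : ∀ {b} → toSign b ≡ zer → b ≡ false
toSign≡zer⇒false {false} _ = refl

∧≡·ᵇ : ∀ a b → a ∧ b ≡ a Xor.·ᵇ b
∧≡·ᵇ true  b = refl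
∧≡·ᵇ false b = refl

InFamilyΛᵇ : ∀ {n m} → ℕ → (Fin m → F2 n) → Set
InFamilyΛᵇ {n} {m} k v = (b : Fin m → Bool) →
  ∑[ i < m ] (b i ·ᵇ v i) ≡ 0v → Nat.sum (λ i → b i Nat.·ᵇ 1) ≤ k → ∀ i → b i ≡ false

-- A 0/1 relation b among the v i = λs (g i) is pushed forward along g to the relation with
-- coefficients push j = Σ_{g i = j} b i (mod 2) among the λs j; injectivity of g gives push ∘ g = b.
InFamilyΛ⇒InFamilyΛᵇ : ∀ {n M m k} {λs : Fin M → F2 n} {v : Fin m → F2 n} → InFamilyΛ k λs →
  Injective _≡_ _≡_ v → (∀ i → ∃ λ j → v i ≡ λs j) → InFamilyΛᵇ k v
InFamilyΛ⇒InFamilyΛᵇ {n} {M} {m} {k} {λs} {v} Λk v-inj v⊆λs b relation≡0 weight≤k i =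
  trans (sym (push-g i)) (toSign≡zer⇒false (Λk (toSign ∘ push) relation short (g i)))
  where
  g : Fin m → Fin M
  g i = proj₁ (v⊆λs i)
  v≡λs∘g : ∀ i → v i ≡ λs (g i)
  v≡λs∘g i = proj₂ (v⊆λs i)
  g-inj : Injective _≡_ _≡_ g
  g-inj {i} {j} gi≡gj = v-inj (trans (v≡λs∘g i) (trans (cong λs gi≡gj) (sym (v≡λs∘g j))))
  push : Fin M → Bool
  push j = Xor.sum (λ i → does (g i ≟ j) ∧ b i)
  relation : sumF M (λ j → toSign (push j) · λs j) ≡ 0v
  relation = begin
    sumF M (λ j → toSign (push j) · λs j)                   ≡⟨ sumF≡∑ M _ ⟩
    ∑[ j < M ] (toSign (push j) · λs j)                     ≡⟨ sum-cong-≗ (λ j → toSign-· (push j) (λs j)) ⟩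
    ∑[ j < M ] (push j ·ᵇ λs j)                             ≡⟨ sum-cong-≗ (λ j → ⨁-·ᵇ (λ i → does (g i ≟ j) ∧ b i) (λs j)) ⟩
    ∑[ j < M ] ∑[ i < m ] ((does (g i ≟ j) ∧ b i) ·ᵇ λs j) ≡⟨ ∑-pushforward g b λs ⟩
    ∑[ i < m ] (b i ·ᵇ λs (g i))                            ≡⟨ sum-cong-≗ (λ i → cong (b i ·ᵇ_) (sym (v≡λs∘g i))) ⟩
    ∑[ i < m ] (b i ·ᵇ v i)                                 ≡⟨ relation≡0 ⟩
    0v                                                      ∎
    where open ≡-Reasoning
  short : sumℕ M (λ j → ∣ toSign (push j) ∣ₛ) ≤ k
  short = begin
    sumℕ M (λ j → ∣ toSign (push j) ∣ₛ)                           ≡⟨ sumℕ≡∑ M _ ⟩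
    Nat.sum (λ j → ∣ toSign (push j) ∣ₛ)                           ≡⟨ Nat.sum-cong-≗ (λ j → ∣toSign∣ (push j)) ⟩
    Nat.sum (λ j → push j Nat.·ᵇ 1)                                 ≤⟨ sum-mono-≤ (λ j → ⨁-·ᵇ1≤ (λ i → does (g i ≟ j) ∧ b i)) ⟩
    Nat.sum (λ j → Nat.sum (λ i → (does (g i ≟ j) ∧ b i) Nat.·ᵇ 1)) ≡⟨ Nat.∑-pushforward g b (λ _ → 1) ⟩
    Nat.sum (λ i → b i Nat.·ᵇ 1)                                    ≤⟨ weight≤k ⟩
    k                                                             ∎
    where open ≤-Reasoning
  push-g : ∀ i → push (g i) ≡ b i
  push-g i = trans (Xor.sum-cong-≗ (λ i′ → ∧≡·ᵇ (does (g i′ ≟ g i)) (b i′)))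
                   (Xor.∑-δ (λ i′ → does (g i′ ≟ g i)) (dec-true (g i ≟ g i) refl)
                           (λ i′ i′≢i → dec-false (g i′ ≟ g i) (i′≢i ∘ g-inj)) b)

lookup≡false⇒≡0v : ∀ {m} (u : F2 m) → (∀ i → lookup u i ≡ false) → u ≡ 0v
lookup≡false⇒≡0v []      _ = refl
lookup≡false⇒≡0v (b ∷ u) h = cong₂ _∷_ (h zero) (lookup≡false⇒≡0v u (h ∘ suc))

combination-injective : ∀ {n m k} {v : Fin m → F2 n} → InFamilyΛᵇ k v →
  ∀ {u w : F2 m} → weight u + weight w ≤ k →
  combination u (tabulate v) ≡ combination w (tabulate v) → u ≡ w
combination-injective {n} {m} {k} {v} indep {u} {w} weights≤k same =
  x⊕y≡0v⇒x≡y (lookup≡false⇒≡0v (u ⊕ w) (indep (lookup (u ⊕ w)) relation short))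
  where
  relation : ∑[ i < m ] (lookup (u ⊕ w) i ·ᵇ v i) ≡ 0v
  relation = begin
    ∑[ i < m ] (lookup (u ⊕ w) i ·ᵇ v i)                  ≡⟨ sum-cong-≗ (λ i → cong (lookup (u ⊕ w) i ·ᵇ_) (sym (lookup∘tabulate v i))) ⟩
    ∑[ i < m ] (lookup (u ⊕ w) i ·ᵇ lookup (tabulate v) i) ≡⟨ sym (combination-lookup (u ⊕ w) (tabulate v)) ⟩
    combination (u ⊕ w) (tabulate v)                        ≡⟨ combination-⊕ u w (tabulate v) ⟩
    combination u (tabulate v) ⊕ combination w (tabulate v) ≡⟨ cong (_⊕ combination w (tabulate v)) same ⟩
    combination w (tabulate v) ⊕ combination w (tabulate v) ≡⟨ x⊕x≡0v _ ⟩
    0v                                                      ∎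
    where open ≡-Reasoning
  short : Nat.sum (λ i → lookup (u ⊕ w) i Nat.·ᵇ 1) ≤ k
  short = begin
    Nat.sum (λ i → lookup (u ⊕ w) i Nat.·ᵇ 1)                          ≡⟨ Nat.sum-cong-≗ (λ i → cong (lookup (u ⊕ w) i Nat.·ᵇ_) (sym (lookup-replicate i 1))) ⟩
    Nat.sum (λ i → lookup (u ⊕ w) i Nat.·ᵇ lookup (replicate m 1) i) ≡⟨ sym (Nat.combination-lookup (u ⊕ w) (replicate m 1)) ⟩
    weight (u ⊕ w)                                                   ≤⟨ weight-⊕ u w ⟩
    weight u + weight w                                              ≤⟨ weights≤k ⟩
    k                                                                ∎
    where open ≤-Reasoning

module _ {A : Set} where

  ∈-─ : ∀ {x y} {xs : List A} (x∈xs : x ∈ xs) → y ∈ xs → y ≢ x → y ∈ xs ─ x∈xs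
  ∈-─ (here refl)  (here refl)  y≢x = ⊥-elim (y≢x refl)
  ∈-─ (here refl)  (there y∈xs) _   = y∈xs
  ∈-─ (there x∈xs) (here refl)  _   = here refl
  ∈-─ (there x∈xs) (there y∈xs) y≢x = there (∈-─ x∈xs y∈xs y≢x)

  Unique-⊆⇒length≤ : ∀ {xs ys : List A} → Unique xs → (∀ {x} → x ∈ xs → x ∈ ys) → length xs ≤ length ys
  Unique-⊆⇒length≤ {[]}     _               _  = z≤n
  Unique-⊆⇒length≤ {x ∷ xs} {ys} (x∉xs ∷ xs!) xs⊆ys = begin
    suc (length xs)          ≤⟨ s≤s (Unique-⊆⇒length≤ xs! xs⊆ys─x) ⟩
    suc (length (ys ─ x∈ys)) ≡⟨ sym (length-removeAt′ ys (index x∈ys)) ⟩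
    length ys                ∎
    where
    open ≤-Reasoning
    x∈ys = xs⊆ys (here refl)
    xs⊆ys─x : ∀ {y} → y ∈ xs → y ∈ ys ─ x∈ys
    xs⊆ys─x y∈xs = ∈-─ x∈ys (xs⊆ys (there y∈xs)) (All.lookup x∉xs y∈xs ∘ sym)

  Unique-map⁺ : ∀ {B : Set} {f : A → B} {xs} →
    (∀ {x y} → x ∈ xs → y ∈ xs → f x ≡ f y → x ≡ y) → Unique xs → Unique (map f xs)
  Unique-map⁺         f-inj []             = []
  Unique-map⁺ {f = f} f-inj (x∉xs ∷ xs!) =
    All.tabulate fx∉ ∷ Unique-map⁺ (λ x∈ y∈ → f-inj (there x∈) (there y∈)) xs!
    where
    fx∉ : ∀ {z} → z ∈ map f _ → f _ ≢ z
    fx∉ z∈ fx≡z with ∈-map⁻ f z∈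
    ... | y , y∈ , refl = All.lookup x∉xs y∈ (f-inj (here refl) (there y∈) fx≡z)

module _ {A : Set} {P : A → Set} (P? : Decidable P) where

  sum-map-filter : ∀ (f : A → ℕ) xs →
    sum (map f xs) ≡ sum (map f (filter P? xs)) + sum (map f (filter (¬? ∘ P?) xs))
  sum-map-filter f []       = refl
  sum-map-filter f (x ∷ xs) with does (P? x)
  ... | true  = trans (cong (f x +_) (sum-map-filter f xs)) (sym (+-assoc (f x) _ _))
  ... | false = trans (cong (f x +_) (sum-map-filter f xs)) (x+[y+z]≡y+[x+z] (f x) (sum (map f (filter P? xs))) _)

  length-filter-partition : ∀ xs → length xs ≡ length (filter P? xs) + length (filter (¬? ∘ P?) xs)
  length-filter-partition xs = begin
    length xs                                                      ≡⟨ length≡sum-map-1 xs ⟩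
    sum (map (λ _ → 1) xs)                                         ≡⟨ sum-map-filter (λ _ → 1) xs ⟩
    sum (map (λ _ → 1) (filter P? xs)) + sum (map (λ _ → 1) (filter (¬? ∘ P?) xs))
      ≡⟨ sym (cong₂ _+_ (length≡sum-map-1 (filter P? xs)) (length≡sum-map-1 (filter (¬? ∘ P?) xs))) ⟩
    length (filter P? xs) + length (filter (¬? ∘ P?) xs)           ∎
    where
    open ≡-Reasoning
    length≡sum-map-1 : ∀ (ys : List A) → length ys ≡ sum (map (λ _ → 1) ys)
    length≡sum-map-1 []       = refl
    length≡sum-map-1 (y ∷ ys) = cong suc (length≡sum-map-1 ys)

-- Enumerating Boolean vectors of a given weight

ofWeight : ∀ m → ℕ → List (F2 m)
ofWeight zero    zero    = [] ∷ []
ofWeight zero    (suc d) = []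
ofWeight (suc m) zero    = map (false ∷_) (ofWeight m zero)
ofWeight (suc m) (suc d) = map (true ∷_) (ofWeight m d) ++ˡ map (false ∷_) (ofWeight m (suc d))

length-ofWeight : ∀ m d → length (ofWeight m d) ≡ m C d
length-ofWeight zero    zero    = refl
length-ofWeight zero    (suc d) = refl
length-ofWeight (suc m) zero    = trans (length-map _ (ofWeight m zero)) (length-ofWeight m zero)
length-ofWeight (suc m) (suc d) = begin
  length (map (true ∷_) (ofWeight m d) ++ˡ map (false ∷_) (ofWeight m (suc d)))  ≡⟨ length-++ (map (true ∷_) (ofWeight m d)) ⟩
  length (map (true ∷_) (ofWeight m d)) + length (map (false ∷_) (ofWeight m (suc d)))
    ≡⟨ cong₂ _+_ (length-map _ (ofWeight m d)) (length-map _ (ofWeight m (suc d))) ⟩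
  length (ofWeight m d) + length (ofWeight m (suc d))  ≡⟨ cong₂ _+_ (length-ofWeight m d) (length-ofWeight m (suc d)) ⟩
  m C d + m C suc d                                    ≡⟨ sym ([n+1]C[k+1]≡nCk+nC[k+1] m d) ⟩
  suc m C suc d                                        ∎
  where open ≡-Reasoning

∈-ofWeight : ∀ {m} (v : F2 m) → v ∈ ofWeight m (weight v)
∈-ofWeight []          = here refl
∈-ofWeight (true ∷ v)  = ∈-++⁺ˡ (∈-map⁺ (true ∷_) (∈-ofWeight v))
∈-ofWeight {suc m} (false ∷ v) with weight v | ∈-ofWeight v
... | zero  | v∈ = ∈-map⁺ (false ∷_) v∈
... | suc d | v∈ = ∈-++⁺ʳ (map (true ∷_) (ofWeight m d)) (∈-map⁺ (false ∷_) v∈)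

∈-ofWeight⇒weight : ∀ {m d} {v : F2 m} → v ∈ ofWeight m d → weight v ≡ d
∈-ofWeight⇒weight {zero}  {zero}  (here refl) = refl
∈-ofWeight⇒weight {suc m} {zero}  v∈ with ∈-map⁻ _ v∈
... | w , w∈ , refl = ∈-ofWeight⇒weight w∈
∈-ofWeight⇒weight {suc m} {suc d} v∈ with ∈-++⁻ (map (true ∷_) (ofWeight m d)) v∈
... | inj₁ v∈₁ with ∈-map⁻ _ v∈₁
...   | w , w∈ , refl = cong suc (∈-ofWeight⇒weight w∈)
∈-ofWeight⇒weight {suc m} {suc d} v∈ | inj₂ v∈₂ with ∈-map⁻ _ v∈₂
...   | w , w∈ , refl = ∈-ofWeight⇒weight w∈

ofWeight-unique : ∀ m d → Unique (ofWeight m d)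
ofWeight-unique zero    zero    = [] ∷ []
ofWeight-unique zero    (suc d) = []
ofWeight-unique (suc m) zero    = Unique.map⁺ ∷-injectiveʳ (ofWeight-unique m zero)
ofWeight-unique (suc m) (suc d) =
  Unique.++⁺ (Unique.map⁺ ∷-injectiveʳ (ofWeight-unique m d))
             (Unique.map⁺ ∷-injectiveʳ (ofWeight-unique m (suc d)))
             disjoint
  where
  disjoint : ∀ {v} → v ∈ map (true ∷_) (ofWeight m d) × v ∈ map (false ∷_) (ofWeight m (suc d)) → ⊥
  disjoint (v∈₁ , v∈₂) with ∈-map⁻ _ v∈₁ | ∈-map⁻ _ v∈₂
  ... | _ , _ , refl | _ , _ , ()

trues : ∀ t → ℕ → F2 t
trues zero    r       = []
trues (suc t) zero    = false ∷ trues t zero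
trues (suc t) (suc r) = true ∷ trues t r

weight-trues : ∀ {t r} → r ≤ t → weight (trues t r) ≡ r
weight-trues {zero}  {zero}  _         = refl
weight-trues {suc t} {zero}  _         = weight-trues {t} z≤n
weight-trues {suc t} {suc r} (s≤s r≤t) = cong suc (weight-trues r≤t)

combinationsOfWeight : ∀ {n m} → Vec (F2 n) m → ℕ → List (F2 n)
combinationsOfWeight {m = m} as d = map (λ v → combination v as) (ofWeight m d)

length-combinationsOfWeight : ∀ {n m} (as : Vec (F2 n) m) d → length (combinationsOfWeight as d) ≡ m C d
length-combinationsOfWeight {m = m} as d = trans (length-map _ (ofWeight m d)) (length-ofWeight m d)

-- Padding by t zero vectors turns a combination of at most t elements into one of exactly t elements.
weight≤⇒∈-combinationsOfWeight : ∀ {n m t} (as : Vec (F2 n) m) {v : F2 m} → weight v ≤ t →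
  combination v as ∈ combinationsOfWeight (as ++ replicate t 0v) t
weight≤⇒∈-combinationsOfWeight {t = t} as {v} weight≤t =
  subst (_∈ _) combination-padded (∈-map⁺ (λ w → combination w (as ++ replicate t 0v)) padded∈)
  where
  padded = v ++ trues t (t ∸ weight v)
  weight-padded : weight padded ≡ t
  weight-padded = trans (weight-++ v _) (trans (cong (weight v +_) (weight-trues (m∸n≤m t (weight v))))
                                               (m+[n∸m]≡n weight≤t))
  padded∈ : padded ∈ ofWeight _ t
  padded∈ = subst (λ d → padded ∈ ofWeight _ d) weight-padded (∈-ofWeight padded)
  combination-padded : combination padded (as ++ replicate t 0v) ≡ combination v as
  combination-padded = trans (combination-++ v _ as (replicate t 0v))
                             (trans (cong (combination v as ⊕_) (combination-replicate-0# (trues t (t ∸ weight v))))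
                                    (⊕-identityʳ _))

InDotSum-weight : ∀ {n m} (v : F2 m) (g : Fin m → F2 n) → InDotSum (weight v) g (combination v (tabulate g))
InDotSum-weight []          g = (λ ()) , (λ { {()} }) , refl
InDotSum-weight (true ∷ v)  g with InDotSum-weight v (g ∘ suc)
... | f , f-inj , sum≡ = zero ∷ᶠ (suc ∘ f) , ∷ᶠ-injective , cong (g zero ⊕_) sum≡
  where
  ∷ᶠ-injective : Injective _≡_ _≡_ (zero ∷ᶠ (suc ∘ f))
  ∷ᶠ-injective {zero}  {zero}  _  = refl
  ∷ᶠ-injective {suc i} {suc j} eq = cong suc (f-inj (suc-injective eq))
InDotSum-weight (false ∷ v) g with InDotSum-weight v (g ∘ suc)
... | f , f-inj , sum≡ = suc ∘ f , f-inj ∘ suc-injective , trans sum≡ (sym (⊕-identityˡ _))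

SumOfAtMost : ∀ {n m} → ℕ → Vec (F2 n) m → F2 n → Set
SumOfAtMost {m = m} d as x = Σ (F2 m) λ v → weight v ≤ d × combination v as ≡ x

SumOfAtMost-0v : ∀ {n m} (as : Vec (F2 n) m) → SumOfAtMost 0 as 0v
SumOfAtMost-0v {m = m} as = 0v , ≤-reflexive (Nat.combination-0v (replicate m 1)) , F2ⁿ.combination-0v as

SumOfAtMost-⊕ : ∀ {n m d e} {as : Vec (F2 n) m} {x y} →
  SumOfAtMost d as x → SumOfAtMost e as y → SumOfAtMost (d + e) as (x ⊕ y)
SumOfAtMost-⊕ {as = as} (v , v≤d , v≡x) (w , w≤e , w≡y) =
  v ⊕ w , ≤-trans (weight-⊕ v w) (+-mono-≤ v≤d w≤e) , trans (combination-⊕ v w as) (cong₂ _⊕_ v≡x w≡y)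

InDotSum⇒SumOfAtMost : ∀ {n m d} {g : Fin m → F2 n} {x} → InDotSum d g x → SumOfAtMost d (tabulate g) x
InDotSum⇒SumOfAtMost {n} {m} {d} {g} {x} (f , _ , sum≡x) = v , weight≤d , combination≡x
  where
  open ≡-Reasoning
  v = ∑[ j < d ] unit (f j)
  weight≤d : weight v ≤ d
  weight≤d = ≤-trans (weight-∑ (unit ∘ f))
                     (≤-reflexive (trans (Nat.sum-cong-≗ (weight-unit ∘ f)) (sum-ones d)))
  combination≡x : combination v (tabulate g) ≡ x
  combination≡x = begin
    combination v (tabulate g)                 ≡⟨ combination-∑ (unit ∘ f) (tabulate g) ⟩
    ∑[ j < d ] combination (unit (f j)) (tabulate g) ≡⟨ sum-cong-≗ (λ j → trans (combination-unit (f j) _) (lookup∘tabulate g (f j))) ⟩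
    ∑[ j < d ] g (f j)                         ≡⟨ sym (sumF≡∑ d (g ∘ f)) ⟩
    sumF d (g ∘ f)                             ≡⟨ sum≡x ⟩
    x                                          ∎

length-tupleSums : ∀ {n} (A : List (F2 n)) p → length (tupleSums A p) ≡ length A ^ p
length-tupleSums A zero    = refl
length-tupleSums A (suc p) = begin
  length (concatMap (λ s → map (s ⊕_) A) (tupleSums A p)) ≡⟨ length-concatMap-⊕ (tupleSums A p) ⟩
  length (tupleSums A p) * length A                       ≡⟨ cong (_* length A) (length-tupleSums A p) ⟩
  length A ^ p * length A                                 ≡⟨ *-comm (length A ^ p) (length A) ⟩
  length A * length A ^ p                                 ∎
  where
  open ≡-Reasoning
  length-concatMap-⊕ : ∀ L → length (concatMap (λ s → map (s ⊕_) A) L) ≡ length L * length A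
  length-concatMap-⊕ []      = refl
  length-concatMap-⊕ (s ∷ L) = trans (length-++ (map (s ⊕_) A))
                                      (cong₂ _+_ (length-map (s ⊕_) A) (length-concatMap-⊕ L))

∈-tupleSums⁻ : ∀ {n} {A : List (F2 n)} p {s} → s ∈ tupleSums A (suc p) →
  ∃ λ s′ → ∃ λ a → s′ ∈ tupleSums A p × a ∈ A × s ≡ s′ ⊕ a
∈-tupleSums⁻ {A = A} p s∈ with ∈-concat⁻′ (map (λ s′ → map (s′ ⊕_) A) (tupleSums A p)) s∈
... | xs , s∈xs , xs∈ with ∈-map⁻ _ xs∈
...   | s′ , s′∈ , refl with ∈-map⁻ _ s∈xs
...     | a , a∈ , s≡ = s′ , a , s′∈ , a∈ , s≡

tupleSums-SumOfAtMost : ∀ {n m d} {as : Vec (F2 n) m} {A : List (F2 n)} →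
  (∀ {a} → a ∈ A → SumOfAtMost d as a) → ∀ p {s} → s ∈ tupleSums A p → SumOfAtMost (p * d) as s
tupleSums-SumOfAtMost {as = as} A-small zero    (here refl) = SumOfAtMost-0v as
tupleSums-SumOfAtMost {d = d} {as} A-small (suc p) {s} s∈ with ∈-tupleSums⁻ p s∈
... | s′ , a , s′∈ , a∈ , refl =
  subst (λ k → SumOfAtMost k as s) (+-comm (p * d) d)
        (SumOfAtMost-⊕ (tupleSums-SumOfAtMost A-small p s′∈) (A-small a∈))

-- Counting coincident sums

pairs : ∀ {n} → List (F2 n) → List (F2 n) → ℕ
pairs L M = sum (map (λ s → countEq s M) L)

pairs-unique : ∀ {n} (M : List (F2 n)) (go : List (F2 n) → ℕ) → go [] ≡ 0 →
  (∀ s ss → go (s ∷ ss) ≡ countEq s M + go ss) → ∀ L → go L ≡ pairs L M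
pairs-unique M go go[] go∷ []       = go[]
pairs-unique M go go[] go∷ (s ∷ ss) = trans (go∷ s ss) (cong (countEq s M +_) (pairs-unique M go go[] go∷ ss))

-- T is defined through a local function of Defs that cannot be named here; abstracting
-- over `tupleSums A p` lets the unifier instantiate the argument `go` of pairs-unique with it.
T≡pairs : ∀ {n} p (A : List (F2 n)) → T p A ≡ pairs (tupleSums A p) (tupleSums A p)
T≡pairs p A with tupleSums A p | pairs-unique (tupleSums A p) _ refl (λ _ _ → refl)
... | L | go≡pairs = go≡pairs L

module _ {n : ℕ} where

  countEq≡sum : ∀ (s : F2 n) M → countEq s M ≡ sum (map (λ y → if does (s ≟v y) then 1 else 0) M)
  countEq≡sum s []      = refl
  countEq≡sum s (y ∷ M) with s ≟v y
  ... | yes _ = cong suc (countEq≡sum s M)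
  ... | no  _ = countEq≡sum s M

  module _ (u : F2 n) where

    private
      E N : List (F2 n) → List (F2 n)
      E = filter (_≟v u)
      N = filter (¬? ∘ (_≟v u))

    pairs-filterˡ : ∀ L M → pairs L M ≡ pairs (E L) M + pairs (N L) M
    pairs-filterˡ L M = sum-map-filter (_≟v u) (λ s → countEq s M) L

    pairs-filterʳ : ∀ L M → pairs L M ≡ pairs L (E M) + pairs L (N M)
    pairs-filterʳ []      M = refl
    pairs-filterʳ (s ∷ L) M = begin
      countEq s M + pairs L M
        ≡⟨ cong₂ _+_ countEq-split (pairs-filterʳ L M) ⟩
      (countEq s (E M) + countEq s (N M)) + (pairs L (E M) + pairs L (N M))
        ≡⟨ +-interchange (countEq s (E M)) (countEq s (N M)) (pairs L (E M)) (pairs L (N M)) ⟩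
      (countEq s (E M) + pairs L (E M)) + (countEq s (N M) + pairs L (N M)) ∎
      where
      open ≡-Reasoning
      indicator = λ y → if does (s ≟v y) then 1 else 0
      countEq-split : countEq s M ≡ countEq s (E M) + countEq s (N M)
      countEq-split = begin
        countEq s M                                  ≡⟨ countEq≡sum s M ⟩
        sum (map indicator M)                        ≡⟨ sum-map-filter (_≟v u) indicator M ⟩
        sum (map indicator (E M)) + sum (map indicator (N M))
          ≡⟨ sym (cong₂ _+_ (countEq≡sum s (E M)) (countEq≡sum s (N M))) ⟩
        countEq s (E M) + countEq s (N M)            ∎

  countEq-all : ∀ {u : F2 n} {xs} → All (_≡ u) xs → countEq u xs ≡ length xs
  countEq-all     []                    = refl
  countEq-all {u} (refl ∷ xs≡u) with u ≟v u
  ... | yes _   = cong suc (countEq-all xs≡u)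
  ... | no  u≢u = ⊥-elim (u≢u refl)

  pairs-all : ∀ {u : F2 n} {xs} M → All (_≡ u) xs → pairs xs M ≡ length xs * countEq u M
  pairs-all M []            = refl
  pairs-all M (refl ∷ xs≡u) = cong (countEq _ M +_) (pairs-all M xs≡u)

  -- Induction on U: the sums equal to its head u contribute a² to pairs L L, and the
  -- AM–GM step 2ab ≤ k a² + y absorbs the cross term against the remaining ones.
  cauchy-schwarz : ∀ (L U : List (F2 n)) → (∀ {s} → s ∈ L → s ∈ U) →
                   length L * length L ≤ length U * pairs L L
  cauchy-schwarz []      U       _    = z≤n
  cauchy-schwarz (s ∷ L) []      L⊆U with () ← L⊆U (here refl)
  cauchy-schwarz L       (u ∷ U) L⊆U = begin
    length L * length L               ≡⟨ cong (λ l → l * l) (length-filter-partition (_≟v u) L) ⟩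
    (a + b) * (a + b)                 ≡⟨ square-sum a b ⟩
    a * a + 2 * (a * b) + b * b       ≤⟨ +-mono-≤ (+-monoʳ-≤ (a * a) (2ab≤ka²+y a b k y ih)) ih ⟩
    a * a + (k * (a * a) + y) + k * y ≡⟨ regroup (a * a) k y ⟩
    suc k * (a * a + y)               ≤⟨ *-monoʳ-≤ (suc k) diagonal≤ ⟩
    suc k * pairs L L                 ∎
    where
    open ≤-Reasoning
    E = filter (_≟v u) L
    N = filter (¬? ∘ (_≟v u)) L
    a = length E
    b = length N
    k = length U
    y = pairs N N
    N⊆U : ∀ {s} → s ∈ N → s ∈ U
    N⊆U s∈N with s∈L , s≢u ← ∈-filter⁻ (¬? ∘ (_≟v u)) s∈N with L⊆U s∈L
    ... | here s≡u = ⊥-elim (s≢u s≡u)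
    ... | there s∈U = s∈U
    ih : b * b ≤ k * y
    ih = cauchy-schwarz N U N⊆U
    diagonal≤ : a * a + y ≤ pairs L L
    diagonal≤ = begin
      a * a + y                                   ≡⟨ cong (_+ y) (sym (trans (pairs-all E E≡u) (cong (a *_) (countEq-all E≡u)))) ⟩
      pairs E E + pairs N N                       ≤⟨ +-mono-≤ (m≤m+n (pairs E E) (pairs E N)) (m≤n+m (pairs N N) (pairs N E)) ⟩
      (pairs E E + pairs E N) + (pairs N E + pairs N N) ≡⟨ sym (cong₂ _+_ (pairs-filterʳ u E L) (pairs-filterʳ u N L)) ⟩
      pairs E L + pairs N L                       ≡⟨ sym (pairs-filterˡ u L L) ⟩
      pairs L L                                   ∎
      where
      E≡u : All (_≡ u) E
      E≡u = all-filter (_≟v u) L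
    square-sum : ∀ a b → (a + b) * (a + b) ≡ a * a + 2 * (a * b) + b * b
    square-sum = solve-∀
    regroup : ∀ a k y → a + (k * a + y) + k * y ≡ suc k * (a + y)
    regroup = solve-∀

C≤length : ∀ {n m d} {v : Fin m → F2 n} → InFamilyΛᵇ (2 * d) v → (Q : List (F2 n)) →
  (∀ {x} → InDotSum d v x → x ∈ Q) → m C d ≤ length Q
C≤length {m = m} {d} {v} indep Q dΛ̇⊆Q = begin
  m C d                                       ≡⟨ sym (length-combinationsOfWeight (tabulate v) d) ⟩
  length (combinationsOfWeight (tabulate v) d) ≤⟨ Unique-⊆⇒length≤ (Unique-map⁺ injective (ofWeight-unique m d)) ⊆Q ⟩
  length Q                                    ∎
  where
  open ≤-Reasoning
  injective : ∀ {u w} → u ∈ ofWeight m d → w ∈ ofWeight m d →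
              combination u (tabulate v) ≡ combination w (tabulate v) → u ≡ w
  injective u∈ w∈ = combination-injective indep
    (≤-reflexive (trans (cong₂ _+_ (∈-ofWeight⇒weight u∈) (∈-ofWeight⇒weight w∈)) (cong (d +_) (sym (+-identityʳ d)))))
  ⊆Q : ∀ {x} → x ∈ combinationsOfWeight (tabulate v) d → x ∈ Q
  ⊆Q x∈ with u , u∈ , refl ← ∈-map⁻ _ x∈ =
    dΛ̇⊆Q (subst (λ k → InDotSum k v _) (∈-ofWeight⇒weight u∈) (InDotSum-weight u v))

[length^p]²≤C*T : ∀ {n m d} {v : Fin m → F2 n} {Q : List (F2 n)} → (∀ {x} → x ∈ Q → InDotSum d v x) →
  ∀ p → length Q ^ p * length Q ^ p ≤ ((m + p * d) C (p * d)) * T p Q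
[length^p]²≤C*T {m = m} {d} {v} {Q} Q⊆dΛ̇ p =
  subst₂ (λ l c → l * l ≤ c) (length-tupleSums Q p)
         (cong₂ _*_ (length-combinationsOfWeight padded (p * d)) (sym (T≡pairs p Q)))
         (cauchy-schwarz (tupleSums Q p) (combinationsOfWeight padded (p * d)) ⊆padded)
  where
  padded = tabulate v ++ replicate (p * d) 0v
  ⊆padded : ∀ {s} → s ∈ tupleSums Q p → s ∈ combinationsOfWeight padded (p * d)
  ⊆padded s∈ with u , weight≤ , refl ← tupleSums-SumOfAtMost (λ a∈Q → InDotSum⇒SumOfAtMost {g = v} (Q⊆dΛ̇ a∈Q)) p s∈ =
    weight≤⇒∈-combinationsOfWeight (tabulate v) {u} weight≤

proposition11 : (n k d : ℕ) → .{{NonZero k}} → .{{NonZero d}} →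
    (m : ℕ) (λs : Fin m → F2 n) → Injective _≡_ _≡_ λs →
    InFamilyΛ (2 * d) λs →
    (m₁ : ℕ) (λ₁ : Fin m₁ → F2 n) → Injective _≡_ _≡_ λ₁ →
    (∀ i → ∃ λ j → λ₁ i ≡ λs j) →
    (Q : List (F2 n)) → Unique Q → (∀ x → (x ∈ Q) ⇔ InDotSum d λ₁ x) →
    k * (2 * d) ≤ m₁ →
    (p : ℕ) → 2 ≤ p → p ≤ k →
    p ^ (p * d) * length Q ^ p ≤ 2 ^ (3 * p * d) * T p Q
proposition11 n k d m λs _ Λ-2d m₁ λ₁ λ₁-inj λ₁⊆λs Q _ Q≡dΛ̇₁ k·2d≤m₁ p 2≤p p≤k =
  subst (λ c → p ^ t * a ^ p ≤ c * T p Q) 8^t≡2^3pd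
    (*-cancelˡ-≤ B {{>-nonZero (nCk>0 (m≤n+m t m₁))}} (begin
      B * (p ^ t * a ^ p)            ≡⟨ x∙yz≈yx∙z B (p ^ t) (a ^ p) ⟩
      (p ^ t * B) * a ^ p            ≤⟨ *-monoˡ-≤ (a ^ p) (p^[pd]*[m+pd]C[pd]≤8^[pd]*[mCd]^p {p} 2t≤m₁) ⟩
      (8 ^ t * (m₁ C d) ^ p) * a ^ p ≤⟨ *-monoˡ-≤ (a ^ p) (*-monoʳ-≤ (8 ^ t) (^-monoˡ-≤ p C≤a)) ⟩
      (8 ^ t * a ^ p) * a ^ p        ≡⟨ *-assoc (8 ^ t) (a ^ p) (a ^ p) ⟩
      8 ^ t * (a ^ p * a ^ p)        ≤⟨ *-monoʳ-≤ (8 ^ t) ([length^p]²≤C*T {v = λ₁} (Equivalence.to (Q≡dΛ̇₁ _)) p) ⟩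
      8 ^ t * (B * T p Q)            ≡⟨ x∙yz≈y∙xz (8 ^ t) B (T p Q) ⟩
      B * (8 ^ t * T p Q)            ∎))
  where
  open ≤-Reasoning
  t = p * d
  a = length Q
  B = (m₁ + t) C t
  instance
    p≢0 : NonZero p
    p≢0 = >-nonZero (≤-trans (s≤s z≤n) 2≤p)
  2t≤m₁ : 2 * t ≤ m₁
  2t≤m₁ = begin
    2 * (p * d) ≡⟨ x∙yz≈y∙xz 2 p d ⟩
    p * (2 * d) ≤⟨ *-monoˡ-≤ (2 * d) p≤k ⟩
    k * (2 * d) ≤⟨ k·2d≤m₁ ⟩
    m₁          ∎
  C≤a : m₁ C d ≤ a
  C≤a = C≤length (InFamilyΛ⇒InFamilyΛᵇ Λ-2d λ₁-inj λ₁⊆λs) Q (Equivalence.from (Q≡dΛ̇₁ _))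
  8^t≡2^3pd : 8 ^ t ≡ 2 ^ (3 * p * d)
  8^t≡2^3pd = trans (^-*-assoc 2 3 t) (cong (2 ^_) (sym (*-assoc 3 p d)))
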